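{- None of the graphs $P_5$, $C_5$, $\mathit{bull}$, $\mathit{banner}$, $\mathit{house}$, $K_{2,3}$, $\overline{P_2\cup P_3}$ is equidominating.
   Context: All graphs are finite, simple and undirected; $\mathbb{N}=\{1,2,\dots\}$. An mds of $G=(V,E)$ is an inclusion-minimal set $D\subseteq V$ such that every vertex is in $D$ or adjacent to a vertex of $D$. $G$ is equidominating if there exist $t\in\mathbb{N}$ and $w\colon V\to\mathbb{N}$ such that for all $D\subseteq V$: $D$ is an mds iff $\sum_{v\in D}w(v)=t$. $P_5$, $C_5$: path and cycle on 5 vertices. bull: triangle $abc$ plus vertices $d,e$ with edges $ad$, $be$. banner: 4-cycle plus one pendant vertex attached to a cycle vertex. house: 4-cycle $abcd$ plus a vertex $e$ adjacent to $a$ and $b$ (the complement of $P_5$). $K_{2,3}$: complete bipartite graph with parts of sizes 2 and 3. $\overline{P_2\cup P_3}$: complement of the disjoint union of a path on 2 vertices and a path on 3 vertices. -}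

module Defs where

open import Data.Nat using (ℕ; zero; suc; _+_; _≤_; _<_)
open import Data.Bool using (Bool; true; false; T; _∨_; if_then_else_)
open import Data.Fin using (Fin; zero; suc)
open import Data.Fin.Subset using (Subset; _∈_; _⊂_; inside; outside)
open import Data.Vec using (Vec; []; _∷_; lookup)
open import Data.Product using (Σ; ∃; ∃-syntax; _×_; _,_)
open import Data.Empty using (⊥)
open import Data.Sum using (_⊎_)
open import Relation.Nullary using (¬_)
open import Relation.Binary.PropositionalEquality using (_≡_)
open import Function.Bundles using (_⇔_)

record Graph (n : ℕ) : Set where
  field
    adj   : Fin n → Fin n → Bool
    sym   : ∀ u v → adj u v ≡ adj v u
    irrefl : ∀ v → adj v v ≡ false
open Graph public

Dominating : ∀ {n} → Graph n → Subset n → Set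
Dominating {n} G D = ∀ (v : Fin n) → v ∈ D ⊎ (∃[ u ] (u ∈ D × T (adj G u v)))

IsMDS : ∀ {n} → Graph n → Subset n → Set
IsMDS G D = Dominating G D × (∀ D′ → D′ ⊂ D → ¬ Dominating G D′)

weight : ∀ {n} → (Fin n → ℕ) → Subset n → ℕ
weight {zero}  w []            = 0
weight {suc n} w (inside ∷ D)  = w zero + weight (λ i → w (suc i)) D
weight {suc n} w (outside ∷ D) = weight (λ i → w (suc i)) D

Equidominating : ∀ {n} → Graph n → Set
Equidominating {n} G =
  Σ ℕ λ t → Σ (Fin n → ℕ) λ w →
    (1 ≤ t) × (∀ v → 1 ≤ w v) × (∀ (D : Subset n) → IsMDS G D ⇔ (weight w D ≡ t))


v0 v1 v2 v3 v4 : Fin 5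
v0 = zero
v1 = suc zero
v2 = suc (suc zero)
v3 = suc (suc (suc zero))
v4 = suc (suc (suc (suc zero)))

mat : Vec (Vec Bool 5) 5 → Fin 5 → Fin 5 → Bool
mat M i j = lookup (lookup M i) j

t f : Bool
t = true
f = false

-- P5: path 0-1-2-3-4
P5-M : Vec (Vec Bool 5) 5
P5-M = (f ∷ t ∷ f ∷ f ∷ f ∷ [])
     ∷ (t ∷ f ∷ t ∷ f ∷ f ∷ [])
     ∷ (f ∷ t ∷ f ∷ t ∷ f ∷ [])
     ∷ (f ∷ f ∷ t ∷ f ∷ t ∷ [])
     ∷ (f ∷ f ∷ f ∷ t ∷ f ∷ [])
     ∷ []

-- C5: cycle 0-1-2-3-4-0
C5-M : Vec (Vec Bool 5) 5
C5-M = (f ∷ t ∷ f ∷ f ∷ t ∷ [])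
     ∷ (t ∷ f ∷ t ∷ f ∷ f ∷ [])
     ∷ (f ∷ t ∷ f ∷ t ∷ f ∷ [])
     ∷ (f ∷ f ∷ t ∷ f ∷ t ∷ [])
     ∷ (t ∷ f ∷ f ∷ t ∷ f ∷ [])
     ∷ []

-- bull: triangle 0(a) 1(b) 2(c), plus 3(d) adjacent to 0, 4(e) adjacent to 1
bull-M : Vec (Vec Bool 5) 5
bull-M = (f ∷ t ∷ t ∷ t ∷ f ∷ [])
       ∷ (t ∷ f ∷ t ∷ f ∷ t ∷ [])
       ∷ (t ∷ t ∷ f ∷ f ∷ f ∷ [])
       ∷ (t ∷ f ∷ f ∷ f ∷ f ∷ [])
       ∷ (f ∷ t ∷ f ∷ f ∷ f ∷ [])
       ∷ []

-- banner: 4-cycle 0-1-2-3-0 plus pendant 4 attached to 0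
banner-M : Vec (Vec Bool 5) 5
banner-M = (f ∷ t ∷ f ∷ t ∷ t ∷ [])
         ∷ (t ∷ f ∷ t ∷ f ∷ f ∷ [])
         ∷ (f ∷ t ∷ f ∷ t ∷ f ∷ [])
         ∷ (t ∷ f ∷ t ∷ f ∷ f ∷ [])
         ∷ (t ∷ f ∷ f ∷ f ∷ f ∷ [])
         ∷ []

-- house: 4-cycle 0(a)-1(b)-2(c)-3(d)-0 plus 4(e) adjacent to 0 and 1
house-M : Vec (Vec Bool 5) 5
house-M = (f ∷ t ∷ f ∷ t ∷ t ∷ [])
        ∷ (t ∷ f ∷ t ∷ f ∷ t ∷ [])
        ∷ (f ∷ t ∷ f ∷ t ∷ f ∷ [])
        ∷ (t ∷ f ∷ t ∷ f ∷ f ∷ [])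
        ∷ (t ∷ t ∷ f ∷ f ∷ f ∷ [])
        ∷ []

-- K_{2,3}: parts {0,1} and {2,3,4}
K23-M : Vec (Vec Bool 5) 5
K23-M = (f ∷ f ∷ t ∷ t ∷ t ∷ [])
      ∷ (f ∷ f ∷ t ∷ t ∷ t ∷ [])
      ∷ (t ∷ t ∷ f ∷ f ∷ f ∷ [])
      ∷ (t ∷ t ∷ f ∷ f ∷ f ∷ [])
      ∷ (t ∷ t ∷ f ∷ f ∷ f ∷ [])
      ∷ []

-- complement of P2 ∪ P3, where P2 = 0-1 and P3 = 2-3-4:
-- all pairs adjacent except {0,1}, {2,3}, {3,4}
coP2P3-M : Vec (Vec Bool 5) 5
coP2P3-M = (f ∷ f ∷ t ∷ t ∷ t ∷ [])
         ∷ (f ∷ f ∷ t ∷ t ∷ t ∷ [])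
         ∷ (t ∷ t ∷ f ∷ f ∷ t ∷ [])
         ∷ (t ∷ t ∷ f ∷ f ∷ f ∷ [])
         ∷ (t ∷ t ∷ t ∷ f ∷ f ∷ [])
         ∷ []

open import Relation.Binary.PropositionalEquality using (refl)

mkGraph : (M : Vec (Vec Bool 5) 5)
        → (∀ u v → mat M u v ≡ mat M v u)
        → (∀ v → mat M v v ≡ false)
        → Graph 5
mkGraph M s i = record { adj = mat M ; sym = s ; irrefl = i }

all5 : (P : Fin 5 → Set) → P v0 → P v1 → P v2 → P v3 → P v4 → ∀ v → P v
all5 P a b c d e zero = a
all5 P a b c d e (suc zero) = b
all5 P a b c d e (suc (suc zero)) = c
all5 P a b c d e (suc (suc (suc zero))) = d
all5 P a b c d e (suc (suc (suc (suc zero)))) = e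

P5 C5 bull banner house K23 coP2P3 : Graph 5
P5 = mkGraph P5-M
  (λ u → all5 (λ v → mat P5-M u v ≡ mat P5-M v u)
     (all5 (λ u → mat P5-M u v0 ≡ mat P5-M v0 u) refl refl refl refl refl u)
     (all5 (λ u → mat P5-M u v1 ≡ mat P5-M v1 u) refl refl refl refl refl u)
     (all5 (λ u → mat P5-M u v2 ≡ mat P5-M v2 u) refl refl refl refl refl u)
     (all5 (λ u → mat P5-M u v3 ≡ mat P5-M v3 u) refl refl refl refl refl u)
     (all5 (λ u → mat P5-M u v4 ≡ mat P5-M v4 u) refl refl refl refl refl u))
  (all5 (λ v → mat P5-M v v ≡ false) refl refl refl refl refl)

C5 = mkGraph C5-M
  (λ u → all5 (λ v → mat C5-M u v ≡ mat C5-M v u)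
     (all5 (λ u → mat C5-M u v0 ≡ mat C5-M v0 u) refl refl refl refl refl u)
     (all5 (λ u → mat C5-M u v1 ≡ mat C5-M v1 u) refl refl refl refl refl u)
     (all5 (λ u → mat C5-M u v2 ≡ mat C5-M v2 u) refl refl refl refl refl u)
     (all5 (λ u → mat C5-M u v3 ≡ mat C5-M v3 u) refl refl refl refl refl u)
     (all5 (λ u → mat C5-M u v4 ≡ mat C5-M v4 u) refl refl refl refl refl u))
  (all5 (λ v → mat C5-M v v ≡ false) refl refl refl refl refl)

bull = mkGraph bull-M
  (λ u → all5 (λ v → mat bull-M u v ≡ mat bull-M v u)
     (all5 (λ u → mat bull-M u v0 ≡ mat bull-M v0 u) refl refl refl refl refl u)
     (all5 (λ u → mat bull-M u v1 ≡ mat bull-M v1 u) refl refl refl refl refl u)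
     (all5 (λ u → mat bull-M u v2 ≡ mat bull-M v2 u) refl refl refl refl refl u)
     (all5 (λ u → mat bull-M u v3 ≡ mat bull-M v3 u) refl refl refl refl refl u)
     (all5 (λ u → mat bull-M u v4 ≡ mat bull-M v4 u) refl refl refl refl refl u))
  (all5 (λ v → mat bull-M v v ≡ false) refl refl refl refl refl)

banner = mkGraph banner-M
  (λ u → all5 (λ v → mat banner-M u v ≡ mat banner-M v u)
     (all5 (λ u → mat banner-M u v0 ≡ mat banner-M v0 u) refl refl refl refl refl u)
     (all5 (λ u → mat banner-M u v1 ≡ mat banner-M v1 u) refl refl refl refl refl u)
     (all5 (λ u → mat banner-M u v2 ≡ mat banner-M v2 u) refl refl refl refl refl u)
     (all5 (λ u → mat banner-M u v3 ≡ mat banner-M v3 u) refl refl refl refl refl u)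
     (all5 (λ u → mat banner-M u v4 ≡ mat banner-M v4 u) refl refl refl refl refl u))
  (all5 (λ v → mat banner-M v v ≡ false) refl refl refl refl refl)

house = mkGraph house-M
  (λ u → all5 (λ v → mat house-M u v ≡ mat house-M v u)
     (all5 (λ u → mat house-M u v0 ≡ mat house-M v0 u) refl refl refl refl refl u)
     (all5 (λ u → mat house-M u v1 ≡ mat house-M v1 u) refl refl refl refl refl u)
     (all5 (λ u → mat house-M u v2 ≡ mat house-M v2 u) refl refl refl refl refl u)
     (all5 (λ u → mat house-M u v3 ≡ mat house-M v3 u) refl refl refl refl refl u)
     (all5 (λ u → mat house-M u v4 ≡ mat house-M v4 u) refl refl refl refl refl u))
  (all5 (λ v → mat house-M v v ≡ false) refl refl refl refl refl)

K23 = mkGraph K23-M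
  (λ u → all5 (λ v → mat K23-M u v ≡ mat K23-M v u)
     (all5 (λ u → mat K23-M u v0 ≡ mat K23-M v0 u) refl refl refl refl refl u)
     (all5 (λ u → mat K23-M u v1 ≡ mat K23-M v1 u) refl refl refl refl refl u)
     (all5 (λ u → mat K23-M u v2 ≡ mat K23-M v2 u) refl refl refl refl refl u)
     (all5 (λ u → mat K23-M u v3 ≡ mat K23-M v3 u) refl refl refl refl refl u)
     (all5 (λ u → mat K23-M u v4 ≡ mat K23-M v4 u) refl refl refl refl refl u))
  (all5 (λ v → mat K23-M v v ≡ false) refl refl refl refl refl)

coP2P3 = mkGraph coP2P3-M
  (λ u → all5 (λ v → mat coP2P3-M u v ≡ mat coP2P3-M v u)
     (all5 (λ u → mat coP2P3-M u v0 ≡ mat coP2P3-M v0 u) refl refl refl refl refl u)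
     (all5 (λ u → mat coP2P3-M u v1 ≡ mat coP2P3-M v1 u) refl refl refl refl refl u)
     (all5 (λ u → mat coP2P3-M u v2 ≡ mat coP2P3-M v2 u) refl refl refl refl refl u)
     (all5 (λ u → mat coP2P3-M u v3 ≡ mat coP2P3-M v3 u) refl refl refl refl refl u)
     (all5 (λ u → mat coP2P3-M u v4 ≡ mat coP2P3-M v4 u) refl refl refl refl refl u))
  (all5 (λ v → mat coP2P3-M v v ≡ false) refl refl refl refl refl)

module Submission where

-- Proof idea (an exchange argument).  Suppose w, t witness that G is
-- equidominating, and suppose we find sets D, B, A₁, A₂ of vertices with
--   * B, A₁, A₂ minimal dominating sets, so w(B) = w(A₁) = w(A₂) = t,
--   * D + B = A₁ + A₂ as multisets of vertices, so w(D) + w(B) = w(A₁) + w(A₂),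
--   * D not dominating.
-- Then w(D) + t = t + t, hence w(D) = t, so D would be an mds and in particular
-- dominating: a contradiction.

open import Defs hiding (sym)

open import Data.Nat using (ℕ; suc; _+_; _*_) renaming (_≟_ to _≟ℕ_)
open import Data.Nat.Properties
  using (+-identityʳ; *-distribʳ-+; +-cancelʳ-≡; +-commutativeSemigroup)
open import Algebra.Properties.CommutativeSemigroup +-commutativeSemigroup
  using (interchange)
open import Data.Bool using (Bool; true; false; T)
open import Data.Fin using (Fin; zero; suc; _≟_)
open import Data.Fin.Properties using (all?; any?)
open import Data.Fin.Subset using (Subset; _∈_; _⊂_)
open import Data.Fin.Subset.Properties using (_∈?_)
open import Data.Vec using ([]; _∷_; lookup)
open import Data.Product using (_×_; ∃-syntax; _,_; proj₁)
open import Data.Sum using (_⊎_; inj₁; inj₂)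
open import Relation.Nullary using (¬_; Dec; ¬?)
open import Relation.Nullary.Decidable
  using (True; toWitness; T?; _×-dec_; _⊎-dec_; _→-dec_)
open import Relation.Binary.PropositionalEquality
  using (_≡_; refl; sym; cong; cong₂; subst; module ≡-Reasoning)
open import Function.Bundles using (Equivalence)

mult : Bool → ℕ
mult true  = 1
mult false = 0

Balanced : ∀ {n} → Subset n → Subset n → Subset n → Subset n → Set
Balanced D B A₁ A₂ =
  ∀ i → mult (lookup D i) + mult (lookup B i) ≡ mult (lookup A₁ i) + mult (lookup A₂ i)

weight-∷ : ∀ {n} (w : Fin (suc n) → ℕ) s (D : Subset n) →
           weight w (s ∷ D) ≡ mult s * w zero + weight (λ i → w (suc i)) D
weight-∷ w true  D = cong (_+ weight (λ i → w (suc i)) D) (sym (+-identityʳ (w zero)))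
weight-∷ w false D = refl

weight-balanced : ∀ {n} (w : Fin n → ℕ) (D B A₁ A₂ : Subset n) → Balanced D B A₁ A₂ →
                  weight w D + weight w B ≡ weight w A₁ + weight w A₂
weight-balanced w [] [] [] [] bal = refl
weight-balanced w (d ∷ D) (b ∷ B) (a₁ ∷ A₁) (a₂ ∷ A₂) bal = begin
  weight w (d ∷ D) + weight w (b ∷ B)
    ≡⟨ cong₂ _+_ (weight-∷ w d D) (weight-∷ w b B) ⟩
  (mult d * x + W D) + (mult b * x + W B)
    ≡⟨ interchange (mult d * x) (W D) (mult b * x) (W B) ⟩
  (mult d * x + mult b * x) + (W D + W B)
    ≡⟨ cong₂ _+_ (head (mult d) (mult b) (mult a₁) (mult a₂) (bal zero))
                 (weight-balanced w′ D B A₁ A₂ (λ i → bal (suc i))) ⟩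
  (mult a₁ * x + mult a₂ * x) + (W A₁ + W A₂)
    ≡⟨ interchange (mult a₁ * x) (mult a₂ * x) (W A₁) (W A₂) ⟩
  (mult a₁ * x + W A₁) + (mult a₂ * x + W A₂)
    ≡⟨ sym (cong₂ _+_ (weight-∷ w a₁ A₁) (weight-∷ w a₂ A₂)) ⟩
  weight w (a₁ ∷ A₁) + weight w (a₂ ∷ A₂) ∎
  where
  open ≡-Reasoning
  x = w zero
  w′ = λ i → w (suc i)
  W = weight w′
  head : ∀ p q r s → p + q ≡ r + s → p * x + q * x ≡ r * x + s * x
  head p q r s eq = begin
    p * x + q * x ≡⟨ sym (*-distribʳ-+ x p q) ⟩
    (p + q) * x   ≡⟨ cong (_* x) eq ⟩
    (r + s) * x   ≡⟨ *-distribʳ-+ x r s ⟩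
    r * x + s * x ∎

PrivateNeighbour : ∀ {n} → Graph n → Subset n → Fin n → Fin n → Set
PrivateNeighbour {n} G D x v = ∀ (u : Fin n) → u ∈ D → u ≡ v ⊎ T (adj G u v) → u ≡ x

Irredundant : ∀ {n} → Graph n → Subset n → Set
Irredundant {n} G D = ∀ (x : Fin n) → x ∈ D → ∃[ v ] PrivateNeighbour G D x v

-- A dominating, irredundant set is a minimal dominating set: removing a
-- member x leaves x's private neighbour undominated.
private-neighbours⇒mds : ∀ {n} (G : Graph n) (D : Subset n) →
                         Dominating G D → Irredundant G D → IsMDS G D
private-neighbours⇒mds G D dom irr = dom , not-dominating
  where
  not-dominating : ∀ D′ → D′ ⊂ D → ¬ Dominating G D′
  not-dominating D′ (D′⊆D , x , x∈D , x∉D′) dom′ with irr x x∈D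
  ... | v , v-private with dom′ v
  ...   | inj₁ v∈D′ = x∉D′ (subst (_∈ D′) (v-private v (D′⊆D v∈D′) (inj₁ refl)) v∈D′)
  ...   | inj₂ (u , u∈D′ , uv) = x∉D′ (subst (_∈ D′) (v-private u (D′⊆D u∈D′) (inj₂ uv)) u∈D′)

ExchangeCertificate : ∀ {n} → Graph n → Subset n → Subset n → Subset n → Subset n → Set
ExchangeCertificate G D B A₁ A₂ =
  ¬ Dominating G D
  × (Dominating G B × Irredundant G B)
  × (Dominating G A₁ × Irredundant G A₁)
  × (Dominating G A₂ × Irredundant G A₂)
  × Balanced D B A₁ A₂

exchange⇒¬equidominating : ∀ {n} (G : Graph n) (D B A₁ A₂ : Subset n) →
                           ExchangeCertificate G D B A₁ A₂ → ¬ Equidominating G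
exchange⇒¬equidominating G D B A₁ A₂
  (¬domD , (domB , irrB) , (domA₁ , irrA₁) , (domA₂ , irrA₂) , bal) (t , w , _ , _ , mds⇔t) =
  ¬domD (proj₁ (Equivalence.from (mds⇔t D) wD≡t))
  where
  open ≡-Reasoning
  weight-of-mds : ∀ A → Dominating G A → Irredundant G A → weight w A ≡ t
  weight-of-mds A dom irr = Equivalence.to (mds⇔t A) (private-neighbours⇒mds G A dom irr)
  wD≡t : weight w D ≡ t
  wD≡t = +-cancelʳ-≡ t (weight w D) t (begin
    weight w D + t             ≡⟨ cong (weight w D +_) (sym (weight-of-mds B domB irrB)) ⟩
    weight w D + weight w B    ≡⟨ weight-balanced w D B A₁ A₂ bal ⟩
    weight w A₁ + weight w A₂  ≡⟨ cong₂ _+_ (weight-of-mds A₁ domA₁ irrA₁)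
                                            (weight-of-mds A₂ domA₂ irrA₂) ⟩
    t + t                      ∎)

dominating? : ∀ {n} (G : Graph n) (D : Subset n) → Dec (Dominating G D)
dominating? G D = all? λ v → v ∈? D ⊎-dec any? λ u → u ∈? D ×-dec T? (adj G u v)

irredundant? : ∀ {n} (G : Graph n) (D : Subset n) → Dec (Irredundant G D)
irredundant? G D = all? λ x → x ∈? D →-dec any? λ v → all? λ u →
  u ∈? D →-dec (u ≟ v ⊎-dec T? (adj G u v)) →-dec u ≟ x

balanced? : ∀ {n} (D B A₁ A₂ : Subset n) → Dec (Balanced D B A₁ A₂)
balanced? D B A₁ A₂ = all? λ i →
  mult (lookup D i) + mult (lookup B i) ≟ℕ mult (lookup A₁ i) + mult (lookup A₂ i)

certificate? : ∀ {n} (G : Graph n) (D B A₁ A₂ : Subset n) →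
               Dec (ExchangeCertificate G D B A₁ A₂)
certificate? G D B A₁ A₂ =
  ¬? (dominating? G D)
  ×-dec (dominating? G B ×-dec irredundant? G B)
  ×-dec (dominating? G A₁ ×-dec irredundant? G A₁)
  ×-dec (dominating? G A₂ ×-dec irredundant? G A₂)
  ×-dec balanced? D B A₁ A₂

refute : ∀ {n} (G : Graph n) (D B A₁ A₂ : Subset n) →
         {True (certificate? G D B A₁ A₂)} → ¬ Equidominating G
refute G D B A₁ A₂ {ok} = exchange⇒¬equidominating G D B A₁ A₂ (toWitness ok)

S : Bool → Bool → Bool → Bool → Bool → Subset 5
S a b c d e = a ∷ b ∷ c ∷ d ∷ e ∷ []

lemma8p2 : ¬ Equidominating P5 × ¬ Equidominating C5 × ¬ Equidominating bull
           × ¬ Equidominating banner × ¬ Equidominating house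
           × ¬ Equidominating K23 × ¬ Equidominating coP2P3
lemma8p2 =
  refute P5     (S t f f f t) (S f t f t f) (S t f f t f) (S f t f f t) ,
  refute C5     (S t t f f f) (S f f t f t) (S t f t f f) (S f t f f t) ,
  refute bull   (S f f f t t) (S t t f f f) (S t f f f t) (S f t f t f) ,
  refute banner (S f t f f t) (S t f t f f) (S t t f f f) (S f f t f t) ,
  refute house  (S t f f f t) (S f t t f f) (S t t f f f) (S f f t f t) ,
  refute K23    (S f f t t f) (S t t f f f) (S t f t f f) (S f t f t f) ,
  refute coP2P3 (S f f t f t) (S t t f f f) (S t f t f f) (S f t f f t)
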